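{- Let $0<a<b$ be coprime integers and $A=\{0,a,b\}$. Then for every integer $N\ge 1$, $$NA = \{0 , 1,\ldots , bN \} \setminus \big(\mathcal E(A) \cup (bN - \mathcal E(b-A))\big).$$
   Context: $\mathbb N=\{0,1,2,\dots\}$. For an integer $N\ge1$, $NA=\{a_1+\cdots+a_N: a_i\in A\}$ (repetitions allowed). For a finite set $X\subset\mathbb N$, $\mathcal P(X)=\{\sum_{x\in X} n_x x: n_x\in\mathbb N\}$ and $\mathcal E(X)=\mathbb N\setminus\mathcal P(X)$. $b-A=\{b-x:x\in A\}$, and for an integer $m$ and a set $Y$, $m-Y=\{m-y:y\in Y\}$. -}

module Defs where

open import Data.Nat using (ℕ; _+_; _*_; _∸_; _≤_)
open import Data.List using (List; map; length; zipWith)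
open import Data.Nat.ListAction using (sum)
open import Data.Vec using (Vec; toList)
open import Data.List.Membership.Propositional using (_∈_)
open import Data.List.Relation.Unary.All using (All)
open import Data.Product using (Σ; ∃; _×_)
open import Relation.Nullary using (¬_)
open import Relation.Binary.PropositionalEquality using (_≡_)

-- Finite sets of naturals are represented by lists (duplicates harmless).

_∈[_·_] : ℕ → ℕ → List ℕ → Set
x ∈[ N · A ] = Σ (Vec ℕ N) λ v → All (_∈ A) (toList v) × sum (toList v) ≡ x

_∈𝒫_ : ℕ → List ℕ → Set
x ∈𝒫 X = Σ (Vec ℕ (length X)) λ n → sum (zipWith _*_ (toList n) X) ≡ x

_∈ℰ_ : ℕ → List ℕ → Set
x ∈ℰ X = ¬ (x ∈𝒫 X)

-- m - Y for Y ⊆ ℕ: x ∈ (m - Y) ↔ ∃ y ∈ Y, x = m - y (as integers), i.e. x + y = m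
-- (membership tested only for x ∈ ℕ; the theorem intersects with {0..bN} anyway)
_∈_-ℰ_ : ℕ → ℕ → List ℕ → Set
x ∈ m -ℰ Y = ∃ λ y → y ∈ℰ Y × x + y ≡ m

-- b - A  = { b - x : x ∈ A }  (for A ⊆ {0..b})
_-ˢ_ : ℕ → List ℕ → List ℕ
b -ˢ A = map (b ∸_) A

{-# OPTIONS --safe #-}

-- An element of N{0,a,b} is i a + j b with i + j ≤ N; such an x lies in 𝒫(A) and
-- bN − x = (N − i − j) b + i (b − a) lies in 𝒫(b − A). Conversely, write x = i a + j b
-- and bN − x = l b + k (b − a). Reducing i and k modulo b (moving multiples of b·a and
-- b·(b − a) into the b-coefficients) we may assume i, k < b. Adding k a to both sides of
-- x + (bN − x) = bN gives i a ≡ k a (mod b), so i = k by coprimality, and comparing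
-- b-coefficients then yields i + j ≤ N.
module Submission where

open import Defs
open import Data.Nat using (ℕ; zero; suc; _+_; _*_; _∸_; _≤_; _<_; _≟_; _≤?_; z≤n; s≤s; NonZero; >-nonZero)
open import Data.Nat.Properties
open import Data.Nat.DivMod using (_/_; _%_; m≡m%n+[m/n]*n; m%n<n; m<n⇒m%n≡m)
open import Data.Nat.Divisibility using (_∣_; ∣m+n∣m⇒∣n; n∣m*n; n∣m⇒m%n≡0)
open import Data.Nat.Coprimality using (Coprime; gcd≡1⇒coprime; coprime-divisor)
import Data.Nat.Coprimality as Coprime
open import Data.Nat.GCD using (gcd)
open import Data.Nat.ListAction using (sum)
open import Data.Nat.Tactic.RingSolver using (solve-∀)
open import Data.List using (List; _∷_; [])
open import Data.List.Relation.Unary.All using (All; _∷_; [])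
open import Data.List.Relation.Unary.Any using (here; there)
open import Data.List.Membership.Propositional using (_∈_)
open import Data.Vec using (Vec; toList; _∷_; [])
open import Data.Product using (_×_; _,_; ∃; ∃₂)
open import Data.Sum using (_⊎_; inj₁; inj₂; [_,_])
open import Data.Empty using (⊥-elim)
open import Relation.Nullary using (¬_; Dec; yes; no; _×-dec_)
open import Relation.Nullary.Decidable using (map′)
open import Relation.Binary.PropositionalEquality using (_≡_; refl; sym; trans; cong; cong₂; subst)
open import Function.Bundles using (_⇔_; mk⇔; module Equivalence)

open ≤-Reasoning
open Equivalence using (to; from)

private
  variable
    a b c i j k l u v x y N P Q : ℕ

BoundedCombination : ℕ → ℕ → ℕ → ℕ → Set
BoundedCombination a b N x = ∃₂ λ i j → i + j ≤ N × i * a + j * b ≡ x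

boundedCombination? : ∀ a b N x → Dec (BoundedCombination a b N x)
boundedCombination? a b N x =
  map′ (λ (i , _ , j , _ , h) → i , j , h) widen
    (anyUpTo? (λ i → anyUpTo? (λ j → (i + j ≤? N) ×-dec (i * a + j * b ≟ x)) (suc N)) (suc N))
  where
  widen : BoundedCombination a b N x →
          ∃ λ i → i < suc N × ∃ λ j → j < suc N × i + j ≤ N × i * a + j * b ≡ x
  widen (i , j , i+j≤N , e) = i , s≤s (m+n≤o⇒m≤o i i+j≤N) , j , s≤s (m+n≤o⇒n≤o i i+j≤N) , i+j≤N , e

sumset⇒boundedCombination : (w : Vec ℕ N) → All (_∈ 0 ∷ a ∷ b ∷ []) (toList w) →
                            BoundedCombination a b N (sum (toList w))
sumset⇒boundedCombination [] [] = 0 , 0 , z≤n , refl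
sumset⇒boundedCombination {a = a} {b = b} (_ ∷ w) (p ∷ ps)
  with i , j , i+j≤N , e ← sumset⇒boundedCombination w ps | p
... | here refl = i , j , m≤n⇒m≤1+n i+j≤N , e
... | there (here refl) = suc i , j , s≤s i+j≤N , trans (+-assoc a (i * a) (j * b)) (cong (a +_) e)
... | there (there (here refl)) = i , suc j , ≤-trans (≤-reflexive (+-suc i j)) (s≤s i+j≤N) , eq
  where
  eq : i * a + (b + j * b) ≡ b + sum (toList w)
  eq = begin-equality
    i * a + (b + j * b) ≡⟨ +-assoc (i * a) b (j * b) ⟨
    i * a + b + j * b   ≡⟨ cong (_+ j * b) (+-comm (i * a) b) ⟩
    b + i * a + j * b   ≡⟨ +-assoc b (i * a) (j * b) ⟩
    b + (i * a + j * b) ≡⟨ cong (b +_) e ⟩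
    b + sum (toList w)  ∎

boundedCombination⇒sumset : ∀ N i j → i + j ≤ N → (i * a + j * b) ∈[ N · 0 ∷ a ∷ b ∷ [] ]
boundedCombination⇒sumset zero zero zero _ = [] , [] , refl
boundedCombination⇒sumset {a = a} {b = b} (suc N) (suc i) j (s≤s i+j≤N)
  with w , ps , s ← boundedCombination⇒sumset {a = a} {b = b} N i j i+j≤N =
  a ∷ w , there (here refl) ∷ ps , trans (cong (a +_) s) (sym (+-assoc a (i * a) (j * b)))
boundedCombination⇒sumset {a = a} {b = b} (suc N) zero (suc j) (s≤s j≤N)
  with w , ps , s ← boundedCombination⇒sumset {a = a} {b = b} N zero j j≤N =
  b ∷ w , there (there (here refl)) ∷ ps , cong (b +_) s
boundedCombination⇒sumset {a = a} {b = b} (suc N) zero zero _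
  with w , ps , s ← boundedCombination⇒sumset {a = a} {b = b} N zero zero z≤n =
  0 ∷ w , here refl ∷ ps , s

sumset⇔boundedCombination : x ∈[ N · 0 ∷ a ∷ b ∷ [] ] ⇔ BoundedCombination a b N x
sumset⇔boundedCombination {x = x} {N = N} = mk⇔
  (λ (w , ps , s) → subst (BoundedCombination _ _ N) s (sumset⇒boundedCombination w ps))
  (λ (i , j , i+j≤N , e) → subst (_∈[ N · _ ]) e (boundedCombination⇒sumset N i j i+j≤N))

boundedCombination⇒≤ : a ≤ b → BoundedCombination a b N x → x ≤ b * N
boundedCombination⇒≤ {a = a} {b = b} {N = N} a≤b (i , j , i+j≤N , refl) = begin
  i * a + j * b   ≤⟨ +-monoˡ-≤ (j * b) (*-monoʳ-≤ i a≤b) ⟩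
  i * b + j * b   ≡⟨ *-distribʳ-+ b i j ⟨
  (i + j) * b     ≤⟨ *-monoˡ-≤ b i+j≤N ⟩
  N * b           ≡⟨ *-comm N b ⟩
  b * N           ∎

∈𝒫-0ab⇔ : x ∈𝒫 (0 ∷ a ∷ b ∷ []) ⇔ ∃₂ λ i j → i * a + j * b ≡ x
∈𝒫-0ab⇔ {a = a} {b = b} = mk⇔
  (λ { (n ∷ i ∷ j ∷ [] , e) → i , j , trans (sym (drop-zeros n i j)) e })
  (λ (i , j , e) → 0 ∷ i ∷ j ∷ [] , trans (drop-zeros 0 i j) e)
  where
  drop-zeros : ∀ n i j → n * 0 + (i * a + (j * b + 0)) ≡ i * a + j * b
  drop-zeros n i j rewrite *-zeroʳ n | +-identityʳ (j * b) = refl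

∈𝒫-b∸0ab⇔ : x ∈𝒫 (b -ˢ (0 ∷ a ∷ b ∷ [])) ⇔ ∃₂ λ l k → l * b + k * (b ∸ a) ≡ x
∈𝒫-b∸0ab⇔ {b = b} {a = a} = mk⇔
  (λ { (l ∷ k ∷ m ∷ [] , e) → l , k , trans (cong (λ t → l * b + t) (sym (vanish k m))) e })
  (λ (l , k , e) → l ∷ k ∷ 0 ∷ [] , trans (cong (λ t → l * b + t) (+-identityʳ (k * (b ∸ a)))) e)
  where
  vanish : ∀ k m → k * (b ∸ a) + (m * (b ∸ b) + 0) ≡ k * (b ∸ a)
  vanish k m rewrite n∸n≡0 b | *-zeroʳ m = +-identityʳ (k * (b ∸ a))

boundedCombination⇒complement : c + a ≡ b → BoundedCombination a b N x → x + y ≡ b * N →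
                                ∃₂ λ l k → l * b + k * c ≡ y
boundedCombination⇒complement {c = c} {a = a} {N = N} {x = x} {y = y}
                              refl (i , j , i+j≤N , refl) x+y≡bN =
  N ∸ (i + j) , i , +-cancelʳ-≡ x _ _ (begin-equality
    (N ∸ (i + j)) * (c + a) + i * c + x ≡⟨ regroup (N ∸ (i + j)) i j c a ⟩
    (i + j + (N ∸ (i + j))) * (c + a)   ≡⟨ cong (_* (c + a)) (m+[n∸m]≡n i+j≤N) ⟩
    N * (c + a)                         ≡⟨ *-comm N (c + a) ⟩
    (c + a) * N                         ≡⟨ x+y≡bN ⟨
    x + y                               ≡⟨ +-comm x y ⟩
    y + x                               ∎)
  where
  regroup : ∀ r i j c a → r * (c + a) + i * c + (i * a + j * (c + a)) ≡ (i + j + r) * (c + a)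
  regroup = solve-∀

combination-reduce : ∀ a b .{{_ : NonZero b}} i j → i * a + j * b ≡ i % b * a + (j + i / b * a) * b
combination-reduce a b i j = begin-equality
  i * a + j * b                           ≡⟨ cong (λ t → t * a + j * b) (m≡m%n+[m/n]*n i b) ⟩
  (i % b + i / b * b) * a + j * b         ≡⟨ shift (i % b) (i / b) a b j ⟩
  i % b * a + (j + i / b * a) * b         ∎
  where
  shift : ∀ r q a b j → (r + q * b) * a + j * b ≡ r * a + (j + q * a) * b
  shift = solve-∀

residue-unique-≤ : .{{_ : NonZero b}} → Coprime b a → v ≤ u → u < b →
                   u * a + P * b ≡ v * a + Q * b → u ≡ v
residue-unique-≤ {b = b} {a = a} {v = v} {u = u} {P = P} {Q = Q} cop v≤u u<b e
  with d , refl ← m≤n⇒∃[o]m+o≡n v≤u = trans (cong (v +_) d≡0) (+-identityʳ v)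
  where
  cancelled : P * b + d * a ≡ Q * b
  cancelled = +-cancelˡ-≡ (v * a) _ _ (begin-equality
    v * a + (P * b + d * a) ≡⟨ regroup v d a P b ⟩
    (v + d) * a + P * b     ≡⟨ e ⟩
    v * a + Q * b           ∎)
    where
    regroup : ∀ v d a P b → v * a + (P * b + d * a) ≡ (v + d) * a + P * b
    regroup = solve-∀
  b∣d : b ∣ d
  b∣d = coprime-divisor cop (subst (b ∣_) (*-comm d a)
          (∣m+n∣m⇒∣n (subst (b ∣_) (sym cancelled) (n∣m*n Q)) (n∣m*n P)))
  d≡0 : d ≡ 0
  d≡0 = trans (sym (m<n⇒m%n≡m (≤-<-trans (m≤n+m d v) u<b))) (n∣m⇒m%n≡0 d b b∣d)

residue-unique : .{{_ : NonZero b}} → Coprime b a → u < b → v < b →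
                 u * a + P * b ≡ v * a + Q * b → u ≡ v
residue-unique {u = u} {v = v} {P = P} {Q = Q} cop u<b v<b e with ≤-total v u
... | inj₁ v≤u = residue-unique-≤ {P = P} {Q = Q} cop v≤u u<b e
... | inj₂ u≤v = sym (residue-unique-≤ {P = Q} {Q = P} cop u≤v v<b (sym e))

reduced-combinations⇒≤ : .{{_ : NonZero b}} → Coprime b a → c + a ≡ b → i < b → k < b →
                         i * a + j * b + (l * b + k * c) ≡ N * b → i + j ≤ N
reduced-combinations⇒≤ {a = a} {c = c} {i = i} {k = k} {j = j} {l = l} {N = N} cop refl i<b k<b e =
  subst (_≤ N) (cong (_+ j) (sym i≡k)) (subst (k + j ≤_) kjl≡N (m≤m+n (k + j) l))
  where
  shifted : i * a + (k + j + l) * (c + a) ≡ k * a + N * (c + a)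
  shifted = begin-equality
    i * a + (k + j + l) * (c + a)                       ≡⟨ regroup i j k l a c ⟨
    i * a + j * (c + a) + (l * (c + a) + k * c) + k * a ≡⟨ cong (_+ k * a) e ⟩
    N * (c + a) + k * a                                 ≡⟨ +-comm (N * (c + a)) (k * a) ⟩
    k * a + N * (c + a)                                 ∎
    where
    regroup : ∀ i j k l a c →
              i * a + j * (c + a) + (l * (c + a) + k * c) + k * a ≡ i * a + (k + j + l) * (c + a)
    regroup = solve-∀
  i≡k : i ≡ k
  i≡k = residue-unique {P = k + j + l} {Q = N} cop i<b k<b shifted
  kjl≡N : k + j + l ≡ N
  kjl≡N = *-cancelʳ-≡ (k + j + l) N (c + a)
            (+-cancelˡ-≡ (i * a) _ _ (trans shifted (cong (λ t → t * a + N * (c + a)) (sym i≡k))))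

combinations⇒boundedCombination : .{{_ : NonZero b}} → Coprime b a → c + a ≡ b →
                                  i * a + j * b + (l * b + k * c) ≡ b * N →
                                  BoundedCombination a b N (i * a + j * b)
combinations⇒boundedCombination {b = b} {a = a} {c = c} {i = i} {j = j} {l = l} {k = k} {N = N}
                                cop c+a≡b e =
  i % b , j + i / b * a ,
  reduced-combinations⇒≤ {j = j + i / b * a} {l = l + k / b * c}
    cop c+a≡b (m%n<n i b) (m%n<n k b) reduced ,
  sym (combination-reduce a b i j)
  where
  reduced : i % b * a + (j + i / b * a) * b + ((l + k / b * c) * b + k % b * c) ≡ N * b
  reduced = begin-equality
    i % b * a + (j + i / b * a) * b + ((l + k / b * c) * b + k % b * c)
      ≡⟨ cong₂ _+_ (combination-reduce a b i j)
                   (trans (combination-reduce c b k l) (+-comm (k % b * c) _)) ⟨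
    i * a + j * b + (k * c + l * b) ≡⟨ cong (i * a + j * b +_) (+-comm (k * c) (l * b)) ⟩
    i * a + j * b + (l * b + k * c) ≡⟨ e ⟩
    b * N                           ≡⟨ *-comm b N ⟩
    N * b                           ∎

mainTheorem2 : (a b : ℕ) → 0 < a → a < b → gcd a b ≡ 1 →
    (N : ℕ) → 1 ≤ N → (x : ℕ) →
      (x ∈[ N · (0 ∷ a ∷ b ∷ []) ]) ⇔
      ((x ≤ b * N) × ¬ ((x ∈ℰ (0 ∷ a ∷ b ∷ [])) ⊎ (x ∈ b * N -ℰ (b -ˢ (0 ∷ a ∷ b ∷ [])))))
mainTheorem2 a b 0<a a<b gcd≡1 N _ x = mk⇔ necessary sufficient
  where
  instance
    b≢0 : NonZero b
    b≢0 = >-nonZero (<-trans 0<a a<b)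
  A : List ℕ
  A = 0 ∷ a ∷ b ∷ []
  a≤b : a ≤ b
  a≤b = <⇒≤ a<b
  b∸a+a≡b : b ∸ a + a ≡ b
  b∸a+a≡b = m∸n+n≡m a≤b

  necessary : x ∈[ N · A ] → x ≤ b * N × ¬ (x ∈ℰ A ⊎ x ∈ b * N -ℰ (b -ˢ A))
  necessary x∈NA with bc@(i , j , _ , e) ← to sumset⇔boundedCombination x∈NA =
    boundedCombination⇒≤ a≤b bc ,
    [ (λ x∉𝒫 → x∉𝒫 (from ∈𝒫-0ab⇔ (i , j , e)))
    , (λ (y , y∉𝒫 , x+y≡bN) →
         y∉𝒫 (from (∈𝒫-b∸0ab⇔ {a = a}) (boundedCombination⇒complement b∸a+a≡b bc x+y≡bN))) ]

  -- The hypothesis only gives ¬¬ of the two 𝒫-memberships; deciding the conclusion recovers it.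
  sufficient : x ≤ b * N × ¬ (x ∈ℰ A ⊎ x ∈ b * N -ℰ (b -ˢ A)) → x ∈[ N · A ]
  sufficient (x≤bN , ¬E) with boundedCombination? a b N x
  ... | yes bc = from sumset⇔boundedCombination bc
  ... | no ¬bc =
    ⊥-elim (¬E (inj₁ λ x∈𝒫 →
      ¬E (inj₂ (b * N ∸ x , (λ y∈𝒫 → ¬bc (representations⇒bounded x∈𝒫 y∈𝒫)) , m+[n∸m]≡n x≤bN))))
    where
    representations⇒bounded : x ∈𝒫 A → (b * N ∸ x) ∈𝒫 (b -ˢ A) → BoundedCombination a b N x
    representations⇒bounded x∈𝒫 y∈𝒫
      with i , j , refl ← to ∈𝒫-0ab⇔ x∈𝒫 | l , k , e ← to (∈𝒫-b∸0ab⇔ {a = a}) y∈𝒫 =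
      combinations⇒boundedCombination {i = i} {j = j} {l = l} {k = k}
        (Coprime.sym (gcd≡1⇒coprime gcd≡1)) b∸a+a≡b
        (trans (cong (i * a + j * b +_) e) (m+[n∸m]≡n x≤bN))
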